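{- Let $G$ be a finite connected graph with a fixed vertex $w$. Let $c \in \{5,6\}$, take a cycle $C_c$ of length $c$ vertex-disjoint from $G$, and identify one vertex of $C_c$ with $w$. Let $v_2$ be a vertex of the cycle at distance $2$ from $w$ on the cycle, and let $v_1$ be the unique common neighbour of $w$ and $v_2$ on the cycle. Attach a path of length $2$ (with two new vertices) by identifying one of its endpoints with $v_2$, and denote the resulting graph by $G^*$. Then $$\delta_{G^*}(w) = t_{G^*}(w) - t_{G^*-v_1}(w) \leq -2.$$
   Context: All graphs are finite, simple and undirected. For a connected graph $H$ and $x \in V(H)$, the transmission of $x$ is $t_H(x)=\sum_{y\in V(H)}\mathrm{dist}_H(x,y)$. -}

module Defs where

open import Data.Nat using (ℕ; zero; suc; _≤_; _∸_; _≡ᵇ_; _≤ᵇ_)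
open import Data.Bool using (Bool; true; false; T; _∧_; _∨_; not)
open import Data.Fin using (Fin; toℕ)
open import Data.Sum using (_⊎_; inj₁; inj₂)
open import Data.Product using (Σ; _×_; ∃)
open import Data.List using (List; map; _++_; allFin; filterᵇ)
open import Data.Nat.ListAction using (sum)
open import Data.List.Membership.Propositional using (_∈_)
open import Relation.Binary.PropositionalEquality using (_≡_)

data Walk {V : Set} (A : V → V → Bool) : ℕ → V → V → Set where
  here : ∀ {x} → Walk A 0 x x
  step : ∀ {k x y z} → T (A x y) → Walk A k y z → Walk A (suc k) x z

SymmetricAdj : ∀ {V : Set} → (V → V → Bool) → Set
SymmetricAdj {V} A = ∀ (x y : V) → A x y ≡ A y x

IrreflexiveAdj : ∀ {V : Set} → (V → V → Bool) → Set
IrreflexiveAdj {V} A = ∀ (x : V) → A x x ≡ false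

Connected : ∀ {V : Set} → (V → V → Bool) → Set
Connected {V} A = ∀ (x y : V) → ∃ λ k → Walk A k x y

IsDist : ∀ {V : Set} → (V → V → Bool) → V → V → ℕ → Set
IsDist A x y d = Walk A d x y × (∀ k → Walk A k x y → d ≤ k)

-- t_H(x) = t, where vs lists the vertex set of H (each vertex once).
IsTransmission : ∀ {V : Set} → (V → V → Bool) → List V → V → ℕ → Set
IsTransmission {V} A vs x t =
  Σ (V → ℕ) λ d → (∀ y → y ∈ vs → IsDist A x y (d y)) × (t ≡ sum (map d vs))

-- Vertices: inj₁ x for x a vertex of G; inj₂ i for i : Fin (c + 1) new vertices:
--   inj₂ i (i = 0 .. c-2) is the cycle vertex u_{i+1}; the cycle is
--   w - u_1 - u_2 - ... - u_{c-1} - w.  So v1 = u_1 = inj₂ 0, v2 = u_2 = inj₂ 1.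
--   inj₂ (c-1) = p1, inj₂ c = p2; the path is v2 - p1 - p2.

VStar : ℕ → ℕ → Set
VStar n c = Fin n ⊎ Fin (suc c)

newE : ℕ → ℕ → ℕ → Bool
newE c i j = ((j ≡ᵇ suc i) ∧ (j ≤ᵇ c ∸ 2))
           ∨ ((i ≡ᵇ 1) ∧ (j ≡ᵇ c ∸ 1))
           ∨ ((i ≡ᵇ c ∸ 1) ∧ (j ≡ᵇ c))

wE : ℕ → ℕ → Bool
wE c i = (i ≡ᵇ 0) ∨ (i ≡ᵇ c ∸ 2)

finEq : ∀ {n} → Fin n → Fin n → Bool
finEq x y = toℕ x ≡ᵇ toℕ y

GStar : ∀ {n} → (Fin n → Fin n → Bool) → Fin n → (c : ℕ) → VStar n c → VStar n c → Bool
GStar A w c (inj₁ x) (inj₁ y) = A x y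
GStar A w c (inj₁ x) (inj₂ j) = finEq x w ∧ wE c (toℕ j)
GStar A w c (inj₂ i) (inj₁ y) = finEq y w ∧ wE c (toℕ i)
GStar A w c (inj₂ i) (inj₂ j) = newE c (toℕ i) (toℕ j) ∨ newE c (toℕ j) (toℕ i)

allVStar : ∀ n c → List (VStar n c)
allVStar n c = map inj₁ (allFin n) ++ map inj₂ (allFin (suc c))

isV1 : ∀ {n c} → VStar n c → Bool
isV1 (inj₁ _) = false
isV1 (inj₂ i) = toℕ i ≡ᵇ 0

-- H - v : delete all edges at vertices satisfying p (vertex list is filtered separately)
deleteAdj : ∀ {V : Set} → (V → V → Bool) → (V → Bool) → V → V → Bool
deleteAdj A p x y = A x y ∧ not (p x) ∧ not (p y)

-- The vertex w is a cut vertex of G*, separating G from the gadget K: the cycle C_c with its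
-- pendant path, which is G* built over the one-vertex graph. Each side is a retract of G*
-- (collapse the other side onto w), and a retraction never lengthens a walk, so distances from w
-- to a vertex of either side are the distances inside that side; the same holds in G* − v1 with
-- K − v1 in place of K. Hence t_G(w) cancels and δ_{G*}(w) = t_K(w) − t_{K−v1}(w), which a search
-- for shortest walks in K evaluates to 13 − 15 for c = 5 and 16 − 21 for c = 6.

module Submission where

open import Defs
open import Data.Nat using (ℕ; zero; suc; _+_; _<_; _≡ᵇ_; z≤n; s≤s) renaming (_≤_ to _≤ℕ_)
open import Data.Nat.Properties using (≡ᵇ⇒≡; ≡⇒≡ᵇ; ≤-refl; ≤-trans; ≮⇒≥; m≤n⇒m≤1+n; m<1+n⇒m<n∨m≡n; anyUpTo?)
open import Data.Nat.ListAction using (sum)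
open import Data.Nat.ListAction.Properties using (sum-++)
open import Data.Bool using (Bool; true; false; not; T)
open import Data.Bool.Properties using (T-∧; ∧-identityʳ)
open import Data.Fin using (Fin; toℕ) renaming (zero to fzero)
open import Data.Fin.Properties using (toℕ-injective; any?; all?)
import Data.Fin.Properties as Fin
open import Data.Sum using (_⊎_; inj₁; inj₂; [_,_]; map₁)
import Data.Sum.Properties as Sum
open import Data.Product using (Σ; _×_; _,_; ∃; proj₁; proj₂)
open import Data.List using (List; []; _∷_; map; _++_; allFin; filterᵇ)
open import Data.List.Properties using (map-++; map-∘; filter-++; filter-all)
open import Data.List.Relation.Unary.All.Properties using (map⁺)
import Data.List.Relation.Unary.All as All
open import Data.List.Membership.Propositional using (_∈_)
open import Data.List.Membership.Propositional.Properties using (∈-filter⁻; ∈-map⁻; ∈-++⁻)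
open import Data.Integer using (ℤ; +_; -[1+_]; _-_; _⊖_; _≤_)
open import Data.Integer.Properties using ([+m]-[+n]≡m⊖n; +-cancelˡ-⊖; _≤?_)
open import Data.Empty using (⊥-elim)
open import Function using (_∘_; const; id)
open import Function.Bundles using (Equivalence)
open import Relation.Nullary using (Dec; yes; no; ¬_; map′; _×-dec_; _→-dec_; _⊎-dec_)
open import Relation.Nullary.Decidable using (toWitness; T?)
open import Relation.Unary using (Decidable)
open import Relation.Binary.Definitions using (DecidableEquality)
open import Relation.Binary.PropositionalEquality using (_≡_; refl; sym; trans; cong; cong₂; subst; subst₂; module ≡-Reasoning)

open Equivalence using (to; from)

module _ {V W : Set} {A : V → V → Bool} {B : W → W → Bool} (f : V → W) where

  Walk-map : (∀ {x y} → T (A x y) → T (B (f x) (f y))) →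
             ∀ {k x y} → Walk A k x y → Walk B k (f x) (f y)
  Walk-map hom here       = here
  Walk-map hom (step e p) = step (hom e) (Walk-map hom p)

  Walk-contract : (∀ {x y} → T (A x y) → T (B (f x) (f y)) ⊎ f x ≡ f y) →
                  ∀ {k x y} → Walk A k x y → ∃ λ k′ → k′ ≤ℕ k × Walk B k′ (f x) (f y)
  Walk-contract con here = 0 , z≤n , here
  Walk-contract con (step {z = z} e p) with Walk-contract con p | con e
  ... | k′ , k′≤k , q | inj₁ e′   = suc k′ , s≤s k′≤k , step e′ q
  ... | k′ , k′≤k , q | inj₂ fx≡fy = k′ , m≤n⇒m≤1+n k′≤k , subst (λ u → Walk B k′ u (f z)) (sym fx≡fy) q

record Retract {V W : Set} (A : V → V → Bool) (B : W → W → Bool) : Set where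
  field
    section            : W → V
    retraction         : V → W
    section-edge       : ∀ {x y} → T (B x y) → T (A (section x) (section y))
    retraction-edge    : ∀ {x y} → T (A x y) → T (B (retraction x) (retraction y)) ⊎ retraction x ≡ retraction y
    retraction∘section : ∀ x → retraction (section x) ≡ x

  isDist : ∀ {x y d} → IsDist B x y d → IsDist A (section x) (section y) d
  isDist {x} {y} {d} (p , shortest) = Walk-map section section-edge p , bound
    where
    bound : ∀ k → Walk A k (section x) (section y) → d ≤ℕ k
    bound k q with Walk-contract retraction retraction-edge q
    ... | k′ , k′≤k , q′ =
      ≤-trans (shortest k′ (subst₂ (Walk B k′) (retraction∘section x) (retraction∘section y) q′)) k′≤k

module _ {V W : Set} {A : V → V → Bool} {B : W → W → Bool} (R : Retract A B)
         (p : V → Bool) (q : W → Bool) where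
  open Retract R

  deleteAdj-retract : (∀ x → p (section x) ≡ q x) → (∀ x → q (retraction x) ≡ p x) →
                      Retract (deleteAdj A p) (deleteAdj B q)
  deleteAdj-retract p∘s≗q q∘r≗p = record
    { section            = section
    ; retraction         = retraction
    ; section-edge       = section-edge′
    ; retraction-edge    = retraction-edge′
    ; retraction∘section = retraction∘section
    }
    where
    keep : ∀ {U} (f : U → Bool) {x y} → f x ≡ y → T (not y) → T (not (f x))
    keep f eq = subst (T ∘ not) (sym eq)

    section-edge′ : ∀ {x y} → T (deleteAdj B q x y) → T (deleteAdj A p (section x) (section y))
    section-edge′ {x} {y} e with to T-∧ e
    ... | bxy , kx,ky with to T-∧ kx,ky
    ... | kx , ky = from T-∧ (section-edge bxy , from T-∧ (keep p (p∘s≗q x) kx , keep p (p∘s≗q y) ky))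

    retraction-edge′ : ∀ {x y} → T (deleteAdj A p x y) →
                       T (deleteAdj B q (retraction x) (retraction y)) ⊎ retraction x ≡ retraction y
    retraction-edge′ {x} {y} e with to T-∧ e
    ... | axy , kx,ky with to T-∧ kx,ky | retraction-edge axy
    ... | _ , _   | inj₂ rx≡ry = inj₂ rx≡ry
    ... | kx , ky | inj₁ bxy   = inj₁ (from T-∧ (bxy , from T-∧ (keep q (q∘r≗p x) kx , keep q (q∘r≗p y) ky)))

Searchable : Set → Set₁
Searchable V = ∀ {P : V → Set} → Decidable P → Dec (∃ P)

⊎-searchable : ∀ {V W} → Searchable V → Searchable W → Searchable (V ⊎ W)
⊎-searchable sV sW {P} P? = map′ [ (λ (x , px) → inj₁ x , px) , (λ (y , py) → inj₂ y , py) ] split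
                             (sV (P? ∘ inj₁) ⊎-dec sW (P? ∘ inj₂))
  where
  split : ∃ P → ∃ (P ∘ inj₁) ⊎ ∃ (P ∘ inj₂)
  split (inj₁ x , px) = inj₁ (x , px)
  split (inj₂ y , py) = inj₂ (y , py)

module _ {P : ℕ → Set} (P? : Decidable P) where

  leastBelow : ∀ b → (∃ λ m → P m × (∀ {j} → j < m → ¬ P j)) ⊎ (∀ {j} → j < b → ¬ P j)
  leastBelow zero = inj₂ λ ()
  leastBelow (suc b) with leastBelow b
  ... | inj₁ least = inj₁ least
  ... | inj₂ none with P? b
  ...   | yes pb = inj₁ (b , pb , none)
  ...   | no ¬pb = inj₂ λ j<1+b → [ none , (λ { refl → ¬pb }) ] (m<1+n⇒m<n∨m≡n j<1+b)

module Shortest {V : Set} (_≟_ : DecidableEquality V) (search : Searchable V) (A : V → V → Bool) where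

  walk? : ∀ k x y → Dec (Walk A k x y)
  walk? zero    x y = map′ (λ { refl → here }) (λ { here → refl }) (x ≟ y)
  walk? (suc k) x y = map′ (λ (z , e , p) → step e p) (λ { (step e p) → _ , e , p })
                           (search λ z → T? (A x z) ×-dec walk? k z y)

  -- Junk value 0 when no walk of length below b exists.
  distBelow : ℕ → V → V → ℕ
  distBelow b x y = [ proj₁ , const 0 ] (leastBelow (λ k → walk? k x y) b)

  distBelow-isDist : ∀ {b k x y} → k < b → Walk A k x y → IsDist A x y (distBelow b x y)
  distBelow-isDist {b} {k} {x} {y} k<b p with leastBelow (λ k → walk? k x y) b
  ... | inj₁ (m , q , shorter) = q , λ j r → ≮⇒≥ λ j<m → shorter j<m r
  ... | inj₂ none              = ⊥-elim (none k<b p)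

  dist : Connected A → V → V → ℕ
  dist conn x y = distBelow (suc (proj₁ (conn x y))) x y

  dist-isDist : (conn : Connected A) → ∀ x y → IsDist A x y (dist conn x y)
  dist-isDist conn x y = distBelow-isDist ≤-refl (proj₂ (conn x y))

ReachableBelow : ∀ {V : Set} → (V → V → Bool) → ℕ → V → V → Set
ReachableBelow A b x y = ∃ λ k → k < b × Walk A k x y

∈-map-inj₂⁻ : ∀ {X Y : Set} {xs : List X} {ys : List Y} {i} → inj₂ i ∈ map inj₁ xs ++ map inj₂ ys → i ∈ ys
∈-map-inj₂⁻ {xs = xs} m with ∈-++⁻ (map inj₁ xs) m
... | inj₁ m₁ with ∈-map⁻ inj₁ m₁
...   | _ , _ , ()
∈-map-inj₂⁻ m | inj₂ m₂ with ∈-map⁻ inj₂ m₂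
...   | _ , i∈ys , refl = i∈ys

sum-map-[,]-++ : ∀ {X Y : Set} (f : X → ℕ) (g : Y → ℕ) xs ys →
                 sum (map [ f , g ] (map inj₁ xs ++ map inj₂ ys)) ≡ sum (map f xs) + sum (map g ys)
sum-map-[,]-++ f g xs ys = begin
  sum (map [ f , g ] (map inj₁ xs ++ map inj₂ ys))                 ≡⟨ cong sum (map-++ [ f , g ] (map inj₁ xs) _) ⟩
  sum (map [ f , g ] (map inj₁ xs) ++ map [ f , g ] (map inj₂ ys)) ≡⟨ sum-++ (map [ f , g ] (map inj₁ xs)) _ ⟩
  sum (map [ f , g ] (map inj₁ xs)) + sum (map [ f , g ] (map inj₂ ys))
    ≡⟨ cong₂ _+_ (cong sum (sym (map-∘ xs))) (cong sum (sym (map-∘ ys))) ⟩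
  sum (map f xs) + sum (map g ys)                                   ∎
  where open ≡-Reasoning

filterᵇ-map : ∀ {X Y : Set} (p : Y → Bool) (f : X → Y) xs → filterᵇ p (map f xs) ≡ map f (filterᵇ (p ∘ f) xs)
filterᵇ-map p f []       = refl
filterᵇ-map p f (x ∷ xs) with p (f x)
... | true  = cong (f x ∷_) (filterᵇ-map p f xs)
... | false = filterᵇ-map p f xs

[+m+n]-[+m+o]≡n⊖o : ∀ m n o → + (m + n) - + (m + o) ≡ n ⊖ o
[+m+n]-[+m+o]≡n⊖o m n o = trans ([+m]-[+n]≡m⊖n (m + n) (m + o)) (+-cancelˡ-⊖ m n o)

finEq-refl : ∀ {n} (x : Fin n) → T (finEq x x)
finEq-refl x = ≡⇒≡ᵇ (toℕ x) (toℕ x) refl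

finEq⇒≡ : ∀ {n} {x y : Fin n} → T (finEq x y) → x ≡ y
finEq⇒≡ {x = x} {y} e = toℕ-injective (≡ᵇ⇒≡ (toℕ x) (toℕ y) e)

isV1-map₁ : ∀ {m n c} (f : Fin m → Fin n) (v : VStar m c) → isV1 (map₁ f v) ≡ isV1 v
isV1-map₁ f (inj₁ _) = refl
isV1-map₁ f (inj₂ _) = refl

notV1 : ∀ {c} → Fin (suc c) → Bool
notV1 i = not (toℕ i ≡ᵇ 0)

filterᵇ-allVStar : ∀ n c → filterᵇ (not ∘ isV1) (allVStar n c) ≡ map inj₁ (allFin n) ++ map inj₂ (filterᵇ notV1 (allFin (suc c)))
filterᵇ-allVStar n c = begin
  filterᵇ (not ∘ isV1) (map inj₁ (allFin n) ++ map inj₂ (allFin (suc c)))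
    ≡⟨ filter-++ (T? ∘ not ∘ isV1) (map inj₁ (allFin n)) _ ⟩
  filterᵇ (not ∘ isV1) (map inj₁ (allFin n)) ++ filterᵇ (not ∘ isV1) (map inj₂ (allFin (suc c)))
    ≡⟨ cong₂ _++_ (filter-all (T? ∘ not ∘ isV1) (map⁺ (All.universal _ (allFin n))))
                  (filterᵇ-map (not ∘ isV1) inj₂ (allFin (suc c))) ⟩
  map inj₁ (allFin n) ++ map inj₂ (filterᵇ notV1 (allFin (suc c)))  ∎
  where open ≡-Reasoning

Gadget : (c : ℕ) → VStar 1 c → VStar 1 c → Bool
Gadget = GStar (λ _ _ → false) fzero

Gadget-v1 : (c : ℕ) → VStar 1 c → VStar 1 c → Bool
Gadget-v1 c = deleteAdj (Gadget c) isV1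

w° : ∀ {c} → VStar 1 c
w° = inj₁ fzero

module GadgetShortest {c : ℕ} = Shortest (Sum.≡-dec (Fin._≟_ {1}) (Fin._≟_ {suc c})) (⊎-searchable any? any?)

-- A shortest walk visits distinct vertices, and the gadget has c + 2 of them.
gadgetDist : ∀ {c} → (VStar 1 c → VStar 1 c → Bool) → Fin (suc c) → ℕ
gadgetDist {c} K i = GadgetShortest.distBelow K (suc (suc c)) w° (inj₂ i)

gadgetDist-isDist : ∀ {c} (K : VStar 1 c → VStar 1 c → Bool) {i} →
                    ReachableBelow K (suc (suc c)) w° (inj₂ i) → IsDist K w° (inj₂ i) (gadgetDist K i)
gadgetDist-isDist K (k , k<b , p) = GadgetShortest.distBelow-isDist K k<b p

attachAt : ∀ {n c} → Fin n → VStar 1 c → VStar n c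
attachAt w = map₁ (const w)

toGadget : ∀ {n c} → VStar n c → VStar 1 c
toGadget = map₁ (const fzero)

toG : ∀ {n c} → Fin n → VStar n c → Fin n
toG w = [ id , const w ]

module _ {n : ℕ} (A : Fin n → Fin n → Bool) (w : Fin n) (c : ℕ) where

  G-retract : Retract (GStar A w c) A
  G-retract = record
    { section            = inj₁
    ; retraction         = toG w
    ; section-edge       = id
    ; retraction-edge    = λ {x} {y} → contract x y
    ; retraction∘section = λ _ → refl
    }
    where
    contract : ∀ x y → T (GStar A w c x y) →
               T (A (toG w x) (toG w y)) ⊎ toG w x ≡ toG w y
    contract (inj₁ x) (inj₁ y) e = inj₁ e
    contract (inj₁ x) (inj₂ j) e = inj₂ (finEq⇒≡ (proj₁ (to T-∧ e)))
    contract (inj₂ i) (inj₁ y) e = inj₂ (sym (finEq⇒≡ (proj₁ (to T-∧ e))))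
    contract (inj₂ i) (inj₂ j) e = inj₂ refl

  G-retract-v1 : Retract (deleteAdj (GStar A w c) isV1) A
  G-retract-v1 = record
    { section            = inj₁
    ; retraction         = toG w
    ; section-edge       = λ {x} {y} e → subst T (sym (∧-identityʳ (A x y))) e
    ; retraction-edge    = λ {x} {y} e → retraction-edge {x} {y} (proj₁ (to T-∧ e))
    ; retraction∘section = λ _ → refl
    }
    where open Retract G-retract

  Gadget-retract : Retract (GStar A w c) (Gadget c)
  Gadget-retract = record
    { section            = attachAt w
    ; retraction         = toGadget
    ; section-edge       = λ {x} {y} → attach x y
    ; retraction-edge    = λ {x} {y} → collapse x y
    ; retraction∘section = λ { (inj₁ fzero) → refl ; (inj₂ _) → refl }
    }
    where
    attach : ∀ x y → T (Gadget c x y) → T (GStar A w c (attachAt w x) (attachAt w y))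
    attach (inj₁ fzero) (inj₂ j)     e = from T-∧ (finEq-refl w , e)
    attach (inj₂ i)     (inj₁ fzero) e = from T-∧ (finEq-refl w , e)
    attach (inj₂ i)     (inj₂ j)     e = e

    collapse : ∀ x y → T (GStar A w c x y) →
               T (Gadget c (toGadget x) (toGadget y)) ⊎ toGadget x ≡ toGadget y
    collapse (inj₁ x) (inj₁ y) e = inj₂ refl
    collapse (inj₁ x) (inj₂ j) e = inj₁ (proj₂ (to T-∧ e))
    collapse (inj₂ i) (inj₁ y) e = inj₁ (proj₂ (to T-∧ e))
    collapse (inj₂ i) (inj₂ j) e = inj₁ e

  Gadget-retract-v1 : Retract (deleteAdj (GStar A w c) isV1) (Gadget-v1 c)
  Gadget-retract-v1 = deleteAdj-retract Gadget-retract isV1 isV1 (isV1-map₁ (const w)) (isV1-map₁ (const fzero))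

tGadget tGadget-v1 : ℕ → ℕ
tGadget    c = sum (map (gadgetDist (Gadget c)) (allFin (suc c)))
tGadget-v1 c = sum (map (gadgetDist (Gadget-v1 c)) (filterᵇ notV1 (allFin (suc c))))

δGadget : ℕ → ℤ
δGadget c = tGadget c ⊖ tGadget-v1 c

module _ {n : ℕ} (A : Fin n → Fin n → Bool) (conn : Connected A) (w : Fin n) (c : ℕ) where
  open Shortest Fin._≟_ any? A using (dist; dist-isDist)

  transmissionG : ℕ
  transmissionG = sum (map (dist conn w) (allFin n))

  cutVertex-transmission :
    (H : VStar n c → VStar n c → Bool) (K : VStar 1 c → VStar 1 c → Bool) (is : List (Fin (suc c))) →
    (∀ {y d} → IsDist A w y d → IsDist H (inj₁ w) (inj₁ y) d) →
    (∀ {i d} → IsDist K w° (inj₂ i) d → IsDist H (inj₁ w) (inj₂ i) d) →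
    (∀ {i} → i ∈ is → ReachableBelow K (suc (suc c)) w° (inj₂ i)) →
    IsTransmission H (map inj₁ (allFin n) ++ map inj₂ is) (inj₁ w) (transmissionG + sum (map (gadgetDist K) is))
  cutVertex-transmission H K is viaG viaK reachable =
    d , isDist , sym (sum-map-[,]-++ (dist conn w) (gadgetDist K) (allFin n) is)
    where
    d : VStar n c → ℕ
    d = [ dist conn w , gadgetDist K ]

    isDist : ∀ y → y ∈ map inj₁ (allFin n) ++ map inj₂ is → IsDist H (inj₁ w) y (d y)
    isDist (inj₁ y) _ = viaG (dist-isDist conn w y)
    isDist (inj₂ i) m = viaK (gadgetDist-isDist K (reachable (∈-map-inj₂⁻ m)))

  transmission-G* : (∀ i → ReachableBelow (Gadget c) (suc (suc c)) w° (inj₂ i)) →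
    IsTransmission (GStar A w c) (allVStar n c) (inj₁ w) (transmissionG + tGadget c)
  transmission-G* reachable =
    cutVertex-transmission (GStar A w c) (Gadget c) (allFin (suc c))
      (Retract.isDist (G-retract A w c)) (Retract.isDist (Gadget-retract A w c)) (λ {i} _ → reachable i)

  transmission-G*-v1 : (∀ i → T (notV1 i) → ReachableBelow (Gadget-v1 c) (suc (suc c)) w° (inj₂ i)) →
    IsTransmission (deleteAdj (GStar A w c) isV1) (filterᵇ (not ∘ isV1) (allVStar n c)) (inj₁ w)
                   (transmissionG + tGadget-v1 c)
  transmission-G*-v1 reachable =
    subst (λ vs → IsTransmission (deleteAdj (GStar A w c) isV1) vs (inj₁ w) (transmissionG + tGadget-v1 c))
          (sym (filterᵇ-allVStar n c))
          (cutVertex-transmission (deleteAdj (GStar A w c) isV1) (Gadget-v1 c) (filterᵇ notV1 (allFin (suc c)))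
            (Retract.isDist (G-retract-v1 A w c)) (Retract.isDist (Gadget-retract-v1 A w c))
            (λ {i} m → reachable i (proj₂ (∈-filter⁻ (T? ∘ notV1) {xs = allFin (suc c)} m))))

  transmission-difference :
    (∀ i → ReachableBelow (Gadget c) (suc (suc c)) w° (inj₂ i)) →
    (∀ i → T (notV1 i) → ReachableBelow (Gadget-v1 c) (suc (suc c)) w° (inj₂ i)) →
    Σ ℕ λ tS → Σ ℕ λ tT →
      IsTransmission (GStar A w c) (allVStar n c) (inj₁ w) tS
      × IsTransmission (deleteAdj (GStar A w c) isV1) (filterᵇ (not ∘ isV1) (allVStar n c)) (inj₁ w) tT
      × (+ tS - + tT ≡ δGadget c)
  transmission-difference reachable reachable-v1 =
    transmissionG + tGadget c , transmissionG + tGadget-v1 c ,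
    transmission-G* reachable , transmission-G*-v1 reachable-v1 ,
    [+m+n]-[+m+o]≡n⊖o transmissionG (tGadget c) (tGadget-v1 c)

gadgetReachable? : ∀ {c} (K : VStar 1 c → VStar 1 c → Bool) (keep : Fin (suc c) → Bool) →
                   Dec (∀ i → T (keep i) → ReachableBelow K (suc (suc c)) w° (inj₂ i))
gadgetReachable? {c} K keep =
  all? λ i → T? (keep i) →-dec anyUpTo? (λ k → GadgetShortest.walk? K k w° (inj₂ i)) (suc (suc c))

gadget-reachable : ∀ {c} → (c ≡ 5) ⊎ (c ≡ 6) → ∀ i → ReachableBelow (Gadget c) (suc (suc c)) w° (inj₂ i)
gadget-reachable (inj₁ refl) i = toWitness {a? = gadgetReachable? (Gadget 5) (const true)} _ i _
gadget-reachable (inj₂ refl) i = toWitness {a? = gadgetReachable? (Gadget 6) (const true)} _ i _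

gadget-v1-reachable : ∀ {c} → (c ≡ 5) ⊎ (c ≡ 6) → ∀ i → T (notV1 i) → ReachableBelow (Gadget-v1 c) (suc (suc c)) w° (inj₂ i)
gadget-v1-reachable (inj₁ refl) = toWitness {a? = gadgetReachable? (Gadget-v1 5) notV1} _
gadget-v1-reachable (inj₂ refl) = toWitness {a? = gadgetReachable? (Gadget-v1 6) notV1} _

δGadget≤-2 : ∀ {c} → (c ≡ 5) ⊎ (c ≡ 6) → δGadget c ≤ -[1+ 1 ]
δGadget≤-2 (inj₁ refl) = toWitness {a? = δGadget 5 ≤? -[1+ 1 ]} _
δGadget≤-2 (inj₂ refl) = toWitness {a? = δGadget 6 ≤? -[1+ 1 ]} _

lemma3 : (n : ℕ) (A : Fin n → Fin n → Bool) → SymmetricAdj A → IrreflexiveAdj A → Connected A →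
         (w : Fin n) (c : ℕ) → (c ≡ 5) ⊎ (c ≡ 6) →
         Σ ℕ λ tS → Σ ℕ λ tT →
           IsTransmission (GStar A w c) (allVStar n c) (inj₁ w) tS
           × IsTransmission (deleteAdj (GStar A w c) isV1) (filterᵇ (λ v → not (isV1 v)) (allVStar n c)) (inj₁ w) tT
           × ((+ tS) - (+ tT) ≤ -[1+ 1 ])
lemma3 n A _ _ conn w c c∈
  with transmission-difference A conn w c (gadget-reachable c∈) (gadget-v1-reachable c∈)
... | tS , tT , transmission , transmission-v1 , δ≡ =
  tS , tT , transmission , transmission-v1 , subst (_≤ -[1+ 1 ]) (sym δ≡) (δGadget≤-2 c∈)
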